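{- If the number $n$ of values stored in a black-white array (as defined in the context) is a power of two, $n=2^m$, then searching for a value in the black-white array takes $O(\log n)$ time.
   Context: Black-white array (BWA): values from a totally ordered set are stored in a white array $W$ and a black array $B$, each divided into segments, the segment of rank $j$ being the index range $[2^j,2^{j+1}-1]$. A counter $\mathtt{total}$ records the number of stored values; the segment of rank $i$ is active iff bit $i$ of $\mathtt{total}$ is $1$. In a stable state all stored values lie in the active white segments, each sorted in ascending order. Search$(v)$: for the ranks $i$ from the highest down to $0$, if the segment of rank $i$ is active, perform a binary search for $v$ in the white segment of rank $i$; return the index of the first occurrence found, or Nil if $v$ is found in no active segment. -}

module Defs where

open import Level using (Level; _⊔_)
open import Data.Nat using (ℕ; zero; suc; _+_; _∸_; _^_) renaming (_≟_ to _≟ℕ_)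
  renaming (_≤_ to _≤ℕ_; _<_ to _<ℕ_)
open import Data.Nat.DivMod using (_/_; _%_)
open import Data.Nat.Logarithm using (⌊log₂_⌋)
open import Data.Maybe using (Maybe; just; nothing)
open import Data.Product using (_×_; _,_)
open import Data.Sum using (_⊎_)
open import Relation.Nullary using (yes; no)
open import Relation.Binary using (tri<; tri≈; tri>)
open import Relation.Binary.Bundles using (StrictTotalOrder)
open import Relation.Binary.PropositionalEquality using (_≡_)

-- The segment of rank j occupies the index range [2^j, 2^(j+1) - 1],
-- i.e. it starts at 2^j and has length 2^j.
segStart : ℕ → ℕ
segStart j = 2 ^ j

segLen : ℕ → ℕ
segLen j = 2 ^ j

bit : ℕ → ℕ → ℕ
bit n zero    = n % 2
bit n (suc i) = bit (n / 2) i

-- Number of ranks scanned by Search: ranks ⌊log₂ total⌋ down to 0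
-- (no ranks when total = 0).  The highest rank is the rank of the
-- highest set bit of total, i.e. the highest rank in use.
numRanks : ℕ → ℕ
numRanks zero    = 0
numRanks (suc n) = suc ⌊log₂ (suc n) ⌋

module BWADefs {c ℓ₁ ℓ₂ : Level} (O : StrictTotalOrder c ℓ₁ ℓ₂) where
  open StrictTotalOrder O renaming (Carrier to A)

  -- A black-white array: the counter 'total', a white array W and a black
  -- array B (arrays are modelled as total functions from indices to values).
  record BWA : Set c where
    field
      total : ℕ
      W     : ℕ → A
      B     : ℕ → A
  open BWA public

  Active : BWA → ℕ → Set
  Active b i = bit (total b) i ≡ 1

  -- stable state: each active white segment is sorted in ascending order
  -- (the stored values being exactly the contents of the active white segments)
  Stable : BWA → Set (ℓ₁ ⊔ ℓ₂)
  Stable b = ∀ i → Active b i → ∀ k → segStart i ≤ℕ k →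
             suc k <ℕ segStart i + segLen i →
             (W b k < W b (suc k)) ⊎ (W b k ≈ W b (suc k))

  -- Cost model: a computation returns its result together with its running
  -- time, counted in elementary steps (one per comparison probe of a binary
  -- search, one per rank examined in the main loop).

  -- Binary search for v in the array X on the half-open index range
  -- [lo, lo + len).  'fuel' only ensures structural termination; it is
  -- initialised to len, which always suffices.  Each probe costs 1.
  bsearch : (X : ℕ → A) → A → (fuel lo len : ℕ) → Maybe ℕ × ℕ
  bsearch X v zero       lo len = nothing , 0
  bsearch X v (suc fuel) lo zero = nothing , 0
  bsearch X v (suc fuel) lo (suc len) with compare v (X (lo + (suc len) / 2))
  ... | tri< _ _ _ with bsearch X v fuel lo ((suc len) / 2)
  ...   | r , t = r , suc t
  bsearch X v (suc fuel) lo (suc len) | tri≈ _ _ _ = just (lo + (suc len) / 2) , 1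
  bsearch X v (suc fuel) lo (suc len) | tri> _ _ _
    with bsearch X v fuel (suc (lo + (suc len) / 2)) (len ∸ (suc len) / 2)
  ... | r , t = r , suc t

  searchSeg : BWA → A → ℕ → Maybe ℕ × ℕ
  searchSeg b v i = bsearch (W b) v (segLen i) (segStart i) (segLen i)

  searchLoop : BWA → A → ℕ → Maybe ℕ × ℕ
  searchLoop b v zero = nothing , 0
  searchLoop b v (suc i) with bit (total b) i ≟ℕ 1
  ... | no _ with searchLoop b v i
  ...   | r , t = r , suc t
  searchLoop b v (suc i) | yes _ with searchSeg b v i
  ... | just x  , t = just x , suc t
  ... | nothing , t with searchLoop b v i
  ...   | r , t′ = r , suc (t + t′)

  search : BWA → A → Maybe ℕ × ℕ
  search b v = searchLoop b v (numRanks (total b))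

  searchTime : BWA → A → ℕ
  searchTime b v with search b v
  ... | _ , t = t

module Submission where

-- Since n = 2^m, only bit m of the counter is set: the main loop of Search
-- scans the ranks m, m-1, …, 0, and only the top one is active.  The cost is
-- therefore
--   * 1 step for each of the m inactive ranks below m, plus
--   * 1 step for rank m together with one binary search over a segment of
--     length 2^m, which makes at most m + 1 probes,
-- for a total of at most 2m + 2 = 2·⌊log₂ n⌋ + 2 steps.  The bound depends
-- only on the counter, not on the contents of the arrays.

open import Defs
open import Level using (Level)
open import Data.Nat using (ℕ; _+_; _*_; _^_; _≤_)
open import Data.Nat.Logarithm using (⌊log₂_⌋)
open import Data.Product using (∃)
open import Relation.Binary.Bundles using (StrictTotalOrder)
open import Relation.Binary.PropositionalEquality using (_≡_)

open import Data.Nat using (zero; suc; _∸_; _<_; z≤n; s≤s; s≤s⁻¹; NonZero) renaming (_≟_ to _≟ℕ_)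
open import Data.Nat.Properties
open import Data.Nat.DivMod using (_/_; _%_; m≡m%n+[m/n]*n; m%n<n; m*n%n≡0; m*n/n≡m; m<n*o⇒m/o<n)
open import Data.Nat.Logarithm using (⌊log₂[2^n]⌋≡n)
open import Data.Maybe using (just; nothing)
open import Data.Product using (_,_; proj₂)
open import Relation.Nullary using (¬_; yes; no; contradiction)
open import Relation.Binary using (tri<; tri≈; tri>)
open import Relation.Binary.PropositionalEquality using (refl; sym; trans; cong; subst)

half<pow : ∀ n k → n < 2 ^ suc k → n / 2 < 2 ^ k
half<pow n k n<2^k+1 = m<n*o⇒m/o<n (subst (n <_) (*-comm 2 (2 ^ k)) n<2^k+1)

-- After probing the middle of a range of length l + 1, the part above the
-- probe (length l ∸ (l+1)/2) is no longer than the part below it.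
upperPart≤lowerPart : ∀ l → l ∸ suc l / 2 ≤ suc l / 2
upperPart≤lowerPart l = m≤n+o⇒m∸n≤o l q l≤q+q
  where
  open ≤-Reasoning
  q : ℕ
  q = suc l / 2
  l≤q+q : l ≤ q + q
  l≤q+q = s≤s⁻¹ (begin
    suc l             ≡⟨ m≡m%n+[m/n]*n (suc l) 2 ⟩
    suc l % 2 + q * 2 ≤⟨ +-monoˡ-≤ (q * 2) (s≤s⁻¹ (m%n<n (suc l) 2)) ⟩
    1 + q * 2         ≡⟨ cong suc (trans (*-comm q 2) (cong (q +_) (+-identityʳ q))) ⟩
    1 + (q + q)       ∎)

bit-2^ : ∀ m j → j < m → bit (2 ^ m) j ≡ 0
bit-2^ (suc m) zero    _   = trans (cong (_% 2) (*-comm 2 (2 ^ m))) (m*n%n≡0 (2 ^ m) 2)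
bit-2^ (suc m) (suc j) j<m =
  trans (cong (λ x → bit x j) (trans (cong (_/ 2) (*-comm 2 (2 ^ m))) (m*n/n≡m (2 ^ m) 2)))
        (bit-2^ m j (s≤s⁻¹ j<m))

numRanks-2^ : ∀ m → numRanks (2 ^ m) ≡ suc m
numRanks-2^ m = trans (numRanks-suc (2 ^ m) {{m^n≢0 2 m}}) (cong suc (⌊log₂[2^n]⌋≡n m))
  where
  numRanks-suc : ∀ n → .{{_ : NonZero n}} → numRanks n ≡ suc ⌊log₂ n ⌋
  numRanks-suc (suc n) = refl

module SearchCost {c ℓ₁ ℓ₂ : Level} (O : StrictTotalOrder c ℓ₁ ℓ₂) where
  open StrictTotalOrder O using (compare) renaming (Carrier to A)
  open BWADefs O

  bsearch-cost : ∀ (X : ℕ → A) v fuel lo len k → len < 2 ^ k →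
                 proj₂ (bsearch X v fuel lo len) ≤ k
  bsearch-cost X v zero       lo len       k       _  = z≤n
  bsearch-cost X v (suc fuel) lo zero      k       _  = z≤n
  bsearch-cost X v (suc fuel) lo (suc len) zero    (s≤s ())
  bsearch-cost X v (suc fuel) lo (suc len) (suc k) lt with compare v (X (lo + suc len / 2))
  ... | tri< _ _ _ = s≤s (bsearch-cost X v fuel lo (suc len / 2) k (half<pow (suc len) k lt))
  ... | tri≈ _ _ _ = s≤s z≤n
  ... | tri> _ _ _ = s≤s (bsearch-cost X v fuel (suc (lo + suc len / 2)) (len ∸ suc len / 2) k
                           (≤-<-trans (upperPart≤lowerPart len) (half<pow (suc len) k lt)))

  searchSeg-cost : ∀ (b : BWA) v i → proj₂ (searchSeg b v i) ≤ suc i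
  searchSeg-cost b v i = bsearch-cost (W b) v (segLen i) (segStart i) (segLen i) (suc i)
                           (^-monoʳ-< 2 (s≤s (s≤s z≤n)) (n<1+n i))

  loop-inactive : ∀ (b : BWA) v i → (∀ j → j < i → ¬ Active b j) →
                  proj₂ (searchLoop b v i) ≡ i
  loop-inactive b v zero    _        = refl
  loop-inactive b v (suc i) inactive with bit (total b) i ≟ℕ 1
  ... | yes active = contradiction active (inactive i (n<1+n i))
  ... | no _       = cong suc (loop-inactive b v i (λ j j<i → inactive j (m<n⇒m<1+n j<i)))

  -- Examining rank i costs at most i + 2 steps on top of the remaining ranks:
  -- one step for the rank, plus at most i + 1 probes if it is active.
  loop-step : ∀ (b : BWA) v i →
              proj₂ (searchLoop b v (suc i)) ≤ suc (suc i) + proj₂ (searchLoop b v i)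
  loop-step b v i with bit (total b) i ≟ℕ 1
  ... | no _ with searchLoop b v i
  ...   | _ , t = s≤s (m≤n+m t (suc i))
  loop-step b v i | yes _ with searchSeg b v i | searchSeg-cost b v i
  ... | just _ , t  | t≤1+i = s≤s (≤-trans t≤1+i (m≤m+n (suc i) _))
  ... | nothing , t | t≤1+i with searchLoop b v i
  ...   | _ , t′ = s≤s (+-monoˡ-≤ t′ t≤1+i)

  search-cost-2^ : ∀ (b : BWA) v m → total b ≡ 2 ^ m →
                   searchTime b v ≤ 2 * ⌊log₂ (total b) ⌋ + 2
  search-cost-2^ b v m total≡2^m = begin
    searchTime b v                           ≡⟨ cong (λ r → proj₂ (searchLoop b v r)) ranks ⟩
    proj₂ (searchLoop b v (suc m))           ≤⟨ loop-step b v m ⟩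
    suc (suc m) + proj₂ (searchLoop b v m)   ≡⟨ cong (suc (suc m) +_) (loop-inactive b v m lowBits) ⟩
    2 + (m + m)                              ≡⟨ cong (λ x → 2 + (m + x)) (sym (+-identityʳ m)) ⟩
    2 + 2 * m                                ≡⟨ +-comm 2 (2 * m) ⟩
    2 * m + 2                                ≡⟨ cong (λ x → 2 * x + 2) (sym log≡m) ⟩
    2 * ⌊log₂ (total b) ⌋ + 2                ∎
    where
    open ≤-Reasoning
    log≡m : ⌊log₂ (total b) ⌋ ≡ m
    log≡m = trans (cong ⌊log₂_⌋ total≡2^m) (⌊log₂[2^n]⌋≡n m)
    ranks : numRanks (total b) ≡ suc m
    ranks = trans (cong numRanks total≡2^m) (numRanks-2^ m)
    lowBits : ∀ j → j < m → ¬ Active b j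
    lowBits j j<m active = 0≢1+n (trans (sym (bit-2^ m j j<m))
                                        (trans (cong (λ n → bit n j) (sym total≡2^m)) active))

mainTheorem8 : ∀ {c ℓ₁ ℓ₂ : Level} → ∃ λ (K : ℕ) →
    (O : StrictTotalOrder c ℓ₁ ℓ₂) (m : ℕ) (b : BWADefs.BWA O) →
    BWADefs.Stable O b → BWADefs.total b ≡ 2 ^ m →
    (v : StrictTotalOrder.Carrier O) →
    BWADefs.searchTime O b v ≤ K * ⌊log₂ (BWADefs.total b) ⌋ + K
mainTheorem8 = 2 , λ O m b _ total≡2^m v → SearchCost.search-cost-2^ O b v m total≡2^m
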